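{- If $u \in \mathsf{Rec}(D_{m,n})$, then $\mathsf{level}(u)=\mathrm{area}(f_{m,n}(u))-(m+n-1)$.
   Context: $D_{m,n}$ is the complete bipartite digraph with top vertices $v_0,\dots,v_{m-1}$ and bottom vertices $v_m,\dots,v_{m+n-1}$ (arcs both ways between parts), sink $v_0$; $\mathsf{Rec}(D_{m,n})$ is the set of recurrent sandpile configurations $u=(u_1,\ldots,u_{m+n-1})$. $\mathsf{level}(u)=u_1+\cdots+u_{m+n-1}-n(m-1)$. With $(a_1,\ldots,a_{m-1},b_1,\ldots,b_n)$ the top and bottom heights each sorted increasingly, $f_{m,n}(u)$ is the intersection of the Young diagram with corner $(m,0)$ and column heights $(n,1+a_{m-1},\ldots,1+a_1)$ (right to left) with the Young diagram with corner $(0,n)$ and row widths $(1+b_n,\ldots,1+b_1)$ (top to bottom); $\mathrm{area}$ is its number of cells. -}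

module Defs where

open import Data.Nat using (ℕ; zero; suc; _+_; _*_; _∸_; _<_; _≤_; _<ᵇ_; _≡ᵇ_)
open import Data.Nat.Properties using (≤-decTotalOrder)
open import Data.Bool using (Bool; true; false; if_then_else_; _∧_; _xor_)
open import Data.Fin using (Fin; toℕ)
open import Data.Fin.Properties using () renaming (_≟_ to _≟F_)
open import Data.Vec using (Vec; lookup; tabulate; toList; take; drop; _[_]%=_)
open import Data.List using (List; []; _∷_; map; upTo)
open import Data.Nat.ListAction using (sum)
open import Data.Product using (_×_)
open import Data.Integer using (ℤ; +_; _-_)
open import Relation.Nullary.Decidable using (⌊_⌋)
open import Relation.Binary.Construct.Closure.ReflexiveTransitive using (Star)
import Data.List.Sort

-- Vertices v_0..v_{m+n-1}; v_0 (a top vertex) is the sink.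
-- The non-sink vertices v_1..v_{m+n-1} are indexed by
-- i : Fin ((m ∸ 1) + n), where i ↦ v_{1 + toℕ i}.  Hence the first
-- m ∸ 1 indices are the non-sink top vertices v_1..v_{m-1}, and the
-- last n indices are the bottom vertices v_m..v_{m+n-1}.

Vertex : ℕ → ℕ → Set
Vertex m n = Fin ((m ∸ 1) + n)

Config : ℕ → ℕ → Set
Config m n = Vec ℕ ((m ∸ 1) + n)

isTop : (m n : ℕ) → Vertex m n → Bool
isTop m n i = toℕ i <ᵇ (m ∸ 1)

deg : (m n : ℕ) → Vertex m n → ℕ
deg m n i = if isTop m n i then n else m

adj : (m n : ℕ) → Vertex m n → Vertex m n → Bool
adj m n i j = isTop m n i xor isTop m n j

-- toppling the non-sink vertex v: v loses deg v grains, every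
-- non-sink out-neighbour gains one grain (grains sent to the sink vanish).
topple : (m n : ℕ) → Config m n → Vertex m n → Config m n
topple m n c v = tabulate λ x →
  (lookup c x ∸ (if ⌊ x ≟F v ⌋ then deg m n v else 0))
    + (if adj m n v x then 1 else 0)

data Step (m n : ℕ) (c : Config m n) : Config m n → Set where
  addGrain  : (v : Vertex m n) → Step m n c (c [ v ]%= suc)
  legalTopple : (v : Vertex m n) → deg m n v ≤ lookup c v →
                Step m n c (topple m n c v)

Reaches : (m n : ℕ) → Config m n → Config m n → Set
Reaches m n = Star (Step m n)

Stable : (m n : ℕ) → Config m n → Set
Stable m n c = (v : Vertex m n) → lookup c v < deg m n v

Recurrent : (m n : ℕ) → Config m n → Set
Recurrent m n u = Stable m n u × ((c : Config m n) → Reaches m n c u)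

level : (m n : ℕ) → Config m n → ℤ
level m n u = + sum (toList u) - + (n * (m ∸ 1))

open Data.List.Sort ≤-decTotalOrder using (sort)

at : List ℕ → ℕ → ℕ
at []       _       = 0
at (x ∷ xs) zero    = x
at (x ∷ xs) (suc k) = at xs k

-- increasingly sorted top heights a_1 ≤ ⋯ ≤ a_{m-1} (a_k = at as (k-1))
topsSorted : (m n : ℕ) → Config m n → List ℕ
topsSorted m n u = sort (toList (take (m ∸ 1) u))

-- increasingly sorted bottom heights b_1 ≤ ⋯ ≤ b_n (b_k = at bs (k-1))
bottomsSorted : (m n : ℕ) → Config m n → List ℕ
bottomsSorted m n u = sort (toList (drop (m ∸ 1) u))

-- Cells of the m × n grid are (i , j), 0 ≤ i < m the column counted from
-- the left, 0 ≤ j < n the row counted from the bottom; the grid is the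
-- rectangle with corners (0,0) and (m,n).
-- First diagram (corner (m,0)), column heights right to left
-- (n, 1+a_{m-1}, …, 1+a_1): column i has height n if i = m-1,
-- and 1 + a_{i+1} otherwise.
colHeight : (m n : ℕ) → Config m n → ℕ → ℕ
colHeight m n u i =
  if suc i ≡ᵇ m then n else suc (at (topsSorted m n u) i)

-- Second diagram (corner (0,n)), row widths top to bottom
-- (1+b_n, …, 1+b_1): row j (from bottom) has width 1 + b_{j+1}.
rowWidth : (m n : ℕ) → Config m n → ℕ → ℕ
rowWidth m n u j = suc (at (bottomsSorted m n u) j)

inF : (m n : ℕ) → Config m n → ℕ → ℕ → Bool
inF m n u i j = (j <ᵇ colHeight m n u i) ∧ (i <ᵇ rowWidth m n u j)

boolToℕ : Bool → ℕ
boolToℕ true  = 1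
boolToℕ false = 0

area : (m n : ℕ) → Config m n → ℕ
area m n u =
  sum (map (λ i → sum (map (λ j → boolToℕ (inF m n u i j)) (upTo n))) (upTo m))

module Submission where

-- A forbidden subconfiguration of c is a nonempty set P of non-sink
-- vertices in which every vertex carries fewer grains than it has
-- neighbours in P.  Adding a grain or toppling never creates one (when a
-- toppled vertex v lies in P, then P ∖ {v} was already forbidden), and a
-- configuration with (m-1)+n grains everywhere has none; hence, by
-- definition of recurrence, a recurrent configuration has none.
--
-- For a stable configuration u without forbidden subconfiguration the two
-- Young diagrams of f_{m,n}(u) cover the m × n grid: a cell (i , j) lying
-- in neither gives i+1 top heights below j and j+1 bottom heights below i,
-- and these vertices form a forbidden subconfiguration.  Inclusion-exclusion
-- on the grid then gives  area + m n = Σ column heights + Σ row widths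
-- = (k + Σ a + n) + (n + Σ b),  which is the level formula.

open import Defs
open import Data.Bool using (Bool; true; false; _∧_; _∨_; not; if_then_else_)
open import Data.Bool.Properties using (T-≡; xor-comm; xor-same; ∧-identityʳ; ∧-zeroʳ; ∨-zeroʳ)
open import Data.Empty using (⊥-elim)
open import Data.Fin using (Fin; toℕ; inject₁; fromℕ) renaming (zero to fzero; suc to fsuc)
open import Data.Fin.Properties using (toℕ<n; toℕ-inject₁; toℕ-fromℕ)
  renaming (_≟_ to _≟F_; suc-injective to fsuc-injective)
open import Data.Integer using (+_; _-_; _⊖_)
open import Data.Integer.Properties using (m-n≡m⊖n; +-cancelˡ-⊖)
open import Data.List using (List; []; _∷_; map; length; applyUpTo)
open import Data.List.Relation.Binary.Permutation.Propositional using (↭-sym)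
open import Data.List.Relation.Binary.Permutation.Propositional.Properties
  using (All-resp-↭; ↭-length; map⁺)
open import Data.List.Relation.Unary.All using (All; []; _∷_)
open import Data.List.Relation.Unary.Linked using (Linked; []; [-]; _∷_)
import Data.List.Relation.Unary.Linked as Linked
open import Data.List.Relation.Unary.Linked.Properties using (Linked⇒All)
import Data.List.Sort
open import Data.Nat using (ℕ; zero; suc; _≤_; _<_; _+_; _*_; _∸_; z≤n; s≤s; z<s; _<ᵇ_; _≡ᵇ_; _≤?_)
open import Data.Nat.ListAction using (sum)
open import Data.Nat.ListAction.Properties using (sum-↭; sum-++)
open import Data.Nat.Properties
open import Data.Nat.Tactic.RingSolver using (solve-∀)
open import Data.Product using (_×_; _,_; proj₁; proj₂; Σ-syntax)
open import Data.Sum using (inj₁; inj₂)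
open import Data.Vec using (Vec; []; _∷_; lookup; tabulate; toList; take; drop; _[_]%=_)
open import Data.Vec.Properties
  using (lookup∘tabulate; lookup∘updateAt; lookup∘updateAt′; length-toList; take++drop≡id; toList-++)
open import Function using (_∘_; Equivalence)
open import Relation.Binary.Construct.Closure.ReflexiveTransitive using (ε; _◅_)
open import Relation.Binary.PropositionalEquality
open import Relation.Nullary using (Dec; yes; no; ¬_)
open import Relation.Nullary.Decidable using (⌊_⌋; isYes≗does; dec-true; dec-false)
open Data.List.Sort ≤-decTotalOrder using (sort; sort-↭; sort-↗)
open import Algebra.Properties.CommutativeMonoid.Sum +-0-commutativeMonoid
  using (sum-syntax; sum-cong-≗; ∑-distrib-+; ∑-comm; sum-init-last)
  renaming (sum to ∑)

boolToℕ≤1 : ∀ b → boolToℕ b ≤ 1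
boolToℕ≤1 true  = s≤s z≤n
boolToℕ≤1 false = z≤n

boolToℕ-∧≤ : ∀ a b → boolToℕ (a ∧ b) ≤ boolToℕ a
boolToℕ-∧≤ true  b = boolToℕ≤1 b
boolToℕ-∧≤ false b = z≤n

boolToℕ-pos : ∀ b → 0 < boolToℕ b → b ≡ true
boolToℕ-pos true _ = refl

boolToℕ-∨ : ∀ a b → (a ∨ b) ≡ true → boolToℕ (a ∧ b) + 1 ≡ boolToℕ a + boolToℕ b
boolToℕ-∨ true  true  _ = refl
boolToℕ-∨ true  false _ = refl
boolToℕ-∨ false true  _ = refl

<ᵇ-true : ∀ {i j} → i < j → (i <ᵇ j) ≡ true
<ᵇ-true i<j = Equivalence.to T-≡ (<⇒<ᵇ i<j)

<ᵇ-sound : ∀ {i j} → (i <ᵇ j) ≡ true → i < j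
<ᵇ-sound {i} {j} e = <ᵇ⇒< i j (Equivalence.from T-≡ e)

<ᵇ-if : ∀ b {y j i} → (if b then y <ᵇ j else y <ᵇ i) ≡ true → y < (if b then j else i)
<ᵇ-if true  = <ᵇ-sound
<ᵇ-if false = <ᵇ-sound

⌊⌋-yes : ∀ {A : Set} (a? : Dec A) → A → ⌊ a? ⌋ ≡ true
⌊⌋-yes a? a = trans (isYes≗does a?) (dec-true a? a)

⌊⌋-no : ∀ {A : Set} (a? : Dec A) → ¬ A → ⌊ a? ⌋ ≡ false
⌊⌋-no a? ¬a = trans (isYes≗does a?) (dec-false a? ¬a)

∑-const : ∀ N c → ∑[ i < N ] c ≡ N * c
∑-const zero    c = refl
∑-const (suc N) c = cong (_+_ c) (∑-const N c)

∑-mono : ∀ {N} {f g : Fin N → ℕ} → (∀ x → f x ≤ g x) → ∑ f ≤ ∑ g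
∑-mono {zero}  _ = z≤n
∑-mono {suc N} f≤g = +-mono-≤ (f≤g fzero) (∑-mono (f≤g ∘ fsuc))

∑-pos : ∀ {N} (f : Fin N → ℕ) → 0 < ∑ f → Σ[ x ∈ Fin N ] 0 < f x
∑-pos {suc N} f pos with f fzero in f₀
... | suc _ = fzero , subst (0 <_) (sym f₀) z<s
... | zero  = let x , fx>0 = ∑-pos (f ∘ fsuc) pos in fsuc x , fx>0

∑-update : ∀ {N} (v : Fin N) {f g : Fin N → ℕ} {k : ℕ} → f v ≡ g v + k →
           (∀ x → x ≢ v → f x ≡ g x) → ∑ f ≡ ∑ g + k
∑-update {suc N} fzero {f} {g} {k} at-v off-v = begin
  f fzero + ∑ (f ∘ fsuc)      ≡⟨ cong₂ _+_ at-v (sum-cong-≗ (λ x → off-v (fsuc x) λ ())) ⟩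
  g fzero + k + ∑ (g ∘ fsuc)  ≡⟨ +-assoc (g fzero) k _ ⟩
  g fzero + (k + ∑ (g ∘ fsuc)) ≡⟨ cong (_+_ (g fzero)) (+-comm k _) ⟩
  g fzero + (∑ (g ∘ fsuc) + k) ≡⟨ +-assoc (g fzero) _ k ⟨
  g fzero + ∑ (g ∘ fsuc) + k  ∎
  where open ≡-Reasoning
∑-update {suc N} (fsuc v) {f} {g} at-v off-v =
  trans (cong₂ _+_ (off-v fzero λ ())
                   (∑-update v at-v λ x x≢v → off-v (fsuc x) (x≢v ∘ fsuc-injective)))
        (sym (+-assoc (g fzero) _ _))

∑-below : ∀ n h → h ≤ n → ∑[ j < n ] boolToℕ (toℕ j <ᵇ h) ≡ h
∑-below n zero _ = trans (∑-const n 0) (*-zeroʳ n)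
∑-below (suc n) (suc h) (s≤s h≤n) = cong suc (∑-below n h h≤n)

∑-applyUpTo : ∀ n (g f : ℕ → ℕ) → sum (map g (applyUpTo f n)) ≡ ∑[ i < n ] g (f (toℕ i))
∑-applyUpTo zero    g f = refl
∑-applyUpTo (suc n) g f = cong (_+_ (g (f 0))) (∑-applyUpTo n g (f ∘ suc))

∑-lookup : ∀ {N} (g : ℕ → ℕ) (u : Vec ℕ N) → ∑[ x < N ] g (lookup u x) ≡ sum (map g (toList u))
∑-lookup g []      = refl
∑-lookup g (a ∷ u) = cong (_+_ (g a)) (∑-lookup g u)

∑-at : ∀ xs {n} → length xs ≡ n → ∑[ i < n ] at xs (toℕ i) ≡ sum xs
∑-at []       refl = refl
∑-at (x ∷ xs) refl = cong (_+_ x) (∑-at xs refl)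

∑∑ : ∀ {m n} → (Fin m → Fin n → ℕ) → ℕ
∑∑ {m} {n} f = ∑[ i < m ] ∑[ j < n ] f i j

∑∑-cong : ∀ {m n} {f g : Fin m → Fin n → ℕ} → (∀ i j → f i j ≡ g i j) → ∑∑ f ≡ ∑∑ g
∑∑-cong f≡g = sum-cong-≗ (λ i → sum-cong-≗ (f≡g i))

∑∑-distrib-+ : ∀ {m n} (f g : Fin m → Fin n → ℕ) →
               ∑∑ (λ i j → f i j + g i j) ≡ ∑∑ f + ∑∑ g
∑∑-distrib-+ f g = trans (sum-cong-≗ (λ i → ∑-distrib-+ (f i) (g i)))
                         (∑-distrib-+ (λ i → ∑ (f i)) (λ i → ∑ (g i)))

∑∑-covered : ∀ m n (A B : Fin m → Fin n → Bool) → (∀ i j → (A i j ∨ B i j) ≡ true) →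
             ∑∑ (λ i j → boolToℕ (A i j ∧ B i j)) + m * n
               ≡ ∑∑ (λ i j → boolToℕ (A i j)) + ∑∑ (λ i j → boolToℕ (B i j))
∑∑-covered m n A B cover = begin
  ∑∑ a∧b + m * n               ≡⟨ cong (_+_ (∑∑ a∧b)) grid ⟨
  ∑∑ a∧b + ∑∑ one              ≡⟨ ∑∑-distrib-+ a∧b one ⟨
  ∑∑ (λ i j → a∧b i j + 1)     ≡⟨ ∑∑-cong (λ i j → boolToℕ-∨ (A i j) (B i j) (cover i j)) ⟩
  ∑∑ (λ i j → a i j + b i j)   ≡⟨ ∑∑-distrib-+ a b ⟩
  ∑∑ a + ∑∑ b                  ∎
  where
  open ≡-Reasoning
  a∧b a b one : Fin m → Fin n → ℕ
  a∧b i j = boolToℕ (A i j ∧ B i j)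
  a i j = boolToℕ (A i j)
  b i j = boolToℕ (B i j)
  one _ _ = 1
  grid : ∑∑ one ≡ m * n
  grid = trans (sum-cong-≗ {m} {λ _ → ∑[ j < n ] 1} (λ _ → trans (∑-const n 1) (*-identityʳ n)))
               (∑-const m n)

count : (ℕ → Bool) → List ℕ → ℕ
count φ xs = sum (map (boolToℕ ∘ φ) xs)

count-sort : ∀ φ xs → count φ (sort xs) ≡ count φ xs
count-sort φ xs = sum-↭ (map⁺ (boolToℕ ∘ φ) (sort-↭ xs))

All-at : ∀ {R : ℕ → Set} xs {i} → All R xs → i < length xs → R (at xs i)
All-at (x ∷ xs) {zero}  (rx ∷ _)  _           = rx
All-at (x ∷ xs) {suc i} (_ ∷ rxs) (s≤s i<len) = All-at xs rxs i<len

head-≤ : ∀ {x xs} → Linked _≤_ (x ∷ xs) → All (x ≤_) xs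
head-≤ [-]       = []
head-≤ (x≤y ∷ s) = Linked⇒All ≤-trans x≤y s

count-sorted : ∀ xs {i j} → Linked _≤_ xs → i < length xs → at xs i < j →
               suc i ≤ count (_<ᵇ j) xs
count-sorted (x ∷ xs) {zero} _ _ x<j rewrite <ᵇ-true x<j = s≤s z≤n
count-sorted (x ∷ xs) {suc i} s (s≤s i<len) xᵢ<j
  rewrite <ᵇ-true (≤-<-trans (All-at xs (head-≤ s) i<len) xᵢ<j) =
  s≤s (count-sorted xs (Linked.tail s) i<len xᵢ<j)

-- Forbidden subconfigurations and the sandpile dynamics on D_{m,n}.

module Burning (m n : ℕ) where

  VertexSet : Set
  VertexSet = Vertex m n → Bool

  size : VertexSet → ℕ
  size P = ∑[ x < (m ∸ 1) + n ] boolToℕ (P x)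

  neighboursIn : VertexSet → Vertex m n → ℕ
  neighboursIn P w = ∑[ x < (m ∸ 1) + n ] boolToℕ (P x ∧ adj m n w x)

  record Forbidden (c : Config m n) (P : VertexSet) : Set where
    field
      nonempty : 0 < size P
      starved  : ∀ w → P w ≡ true → lookup c w < neighboursIn P w

  Allowed : Config m n → Set
  Allowed c = ∀ P → ¬ Forbidden c P

  adj-sym : ∀ v w → adj m n v w ≡ adj m n w v
  adj-sym v w = xor-comm (isTop m n v) (isTop m n w)

  adj-irrefl : ∀ v → adj m n v v ≡ false
  adj-irrefl v = xor-same (isTop m n v)

  neighboursIn≤size : ∀ P w → neighboursIn P w ≤ size P
  neighboursIn≤size P w = ∑-mono (λ x → boolToℕ-∧≤ (P x) _)

  size≤vertices : ∀ P → size P ≤ (m ∸ 1) + n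
  size≤vertices P = ≤-trans (∑-mono (λ x → boolToℕ≤1 (P x)))
                            (≤-reflexive (trans (∑-const ((m ∸ 1) + n) 1) (*-identityʳ _)))

  forbidden-downward : ∀ {c d P} → (∀ w → P w ≡ true → lookup c w ≤ lookup d w) →
                       Forbidden d P → Forbidden c P
  forbidden-downward c≤d F = record
    { nonempty = nonempty
    ; starved  = λ w w∈P → ≤-<-trans (c≤d w w∈P) (starved w w∈P) }
    where open Forbidden F

  addGrain-≤ : ∀ (c : Config m n) v w → lookup c w ≤ lookup (c [ v ]%= suc) w
  addGrain-≤ c v w with w ≟F v
  ... | yes refl = subst (lookup c v ≤_) (sym (lookup∘updateAt v c)) (n≤1+n _)
  ... | no w≢v   = ≤-reflexive (sym (lookup∘updateAt′ w v w≢v c))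

  lookup-topple : ∀ (c : Config m n) v w → w ≢ v →
                  lookup (topple m n c v) w ≡ lookup c w + boolToℕ (adj m n v w)
  lookup-topple c v w w≢v
    rewrite lookup∘tabulate (λ x → (lookup c x ∸ (if ⌊ x ≟F v ⌋ then deg m n v else 0))
                                     + (if adj m n v x then 1 else 0)) w
          | ⌊⌋-no (w ≟F v) w≢v
    with adj m n v w
  ... | true  = refl
  ... | false = refl

  _without_ : VertexSet → Vertex m n → VertexSet
  (P without v) x = P x ∧ not ⌊ x ≟F v ⌋

  ∈-without : ∀ P v w → (P without v) w ≡ true → P w ≡ true × w ≢ v
  ∈-without P v w w∈ with P w | w ≟F v
  ∈-without P v w ()   | false | _
  ∈-without P v w ()   | true  | yes _
  ∈-without P v w refl | true  | no w≢v = refl , w≢v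

  neighboursIn-without : ∀ P v w →
    neighboursIn P w ≡ neighboursIn (P without v) w + boolToℕ (P v ∧ adj m n w v)
  neighboursIn-without P v w = ∑-update v at-v off-v
    where
    at-v : boolToℕ (P v ∧ adj m n w v)
           ≡ boolToℕ ((P without v) v ∧ adj m n w v) + boolToℕ (P v ∧ adj m n w v)
    at-v rewrite ⌊⌋-yes (v ≟F v) refl | ∧-zeroʳ (P v) = refl
    off-v : ∀ x → x ≢ v → boolToℕ (P x ∧ adj m n w x) ≡ boolToℕ ((P without v) x ∧ adj m n w x)
    off-v x x≢v rewrite ⌊⌋-no (x ≟F v) x≢v | ∧-identityʳ (P x) = refl

  -- If the toppled vertex v lies in a forbidden set P of the result, then
  -- P ∖ {v} is forbidden before the toppling: each w ∈ P ∖ {v} gained a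
  -- grain exactly when v is a neighbour of w, and v's own neighbours in P
  -- witness that P ∖ {v} is nonempty.
  topple-forbidden : ∀ c v P → P v ≡ true → Forbidden (topple m n c v) P →
                     Forbidden c (P without v)
  topple-forbidden c v P v∈P F = record { nonempty = nonempty′ ; starved = starved′ }
    where
    open Forbidden F
    open ≤-Reasoning
    P′ = P without v
    loss : ∀ w → neighboursIn P w ≡ neighboursIn P′ w + boolToℕ (adj m n w v)
    loss w = trans (neighboursIn-without P v w)
                   (cong (λ b → neighboursIn P′ w + boolToℕ (b ∧ adj m n w v)) v∈P)
    nonempty′ : 0 < size P′
    nonempty′ = begin-strict
      0                                         ≤⟨ z≤n ⟩
      lookup (topple m n c v) v                 <⟨ starved v v∈P ⟩
      neighboursIn P v                          ≡⟨ loss v ⟩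
      neighboursIn P′ v + boolToℕ (adj m n v v) ≡⟨ cong (λ b → neighboursIn P′ v + boolToℕ b) (adj-irrefl v) ⟩
      neighboursIn P′ v + 0                     ≡⟨ +-identityʳ _ ⟩
      neighboursIn P′ v                         ≤⟨ neighboursIn≤size P′ v ⟩
      size P′                                   ∎
    starved′ : ∀ w → P′ w ≡ true → lookup c w < neighboursIn P′ w
    starved′ w w∈P′ = +-cancelʳ-< _ _ _ (begin-strict
      lookup c w + boolToℕ (adj m n w v) ≡⟨ cong (λ b → lookup c w + boolToℕ b) (adj-sym w v) ⟩
      lookup c w + boolToℕ (adj m n v w) ≡⟨ lookup-topple c v w w≢v ⟨
      lookup (topple m n c v) w          <⟨ starved w w∈P ⟩
      neighboursIn P w                   ≡⟨ loss w ⟩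
      neighboursIn P′ w + boolToℕ (adj m n w v) ∎)
      where
      w∈P = proj₁ (∈-without P v w w∈P′)
      w≢v = proj₂ (∈-without P v w w∈P′)

  -- Toppling v ∉ P only adds grains on P.
  topple-outside : ∀ c v P → P v ≡ false → Forbidden (topple m n c v) P → Forbidden c P
  topple-outside c v P v∉P = forbidden-downward gain
    where
    gain : ∀ w → P w ≡ true → lookup c w ≤ lookup (topple m n c v) w
    gain w w∈P = subst (lookup c w ≤_) (sym (lookup-topple c v w w≢v)) (m≤m+n _ _)
      where
      w≢v : w ≢ v
      w≢v refl with () ← trans (sym v∉P) w∈P

  step-allowed : ∀ {c d} → Step m n c d → Allowed c → Allowed d
  step-allowed {c} (addGrain v) ok P F = ok P (forbidden-downward (λ w _ → addGrain-≤ c v w) F)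
  step-allowed {c} (legalTopple v _) ok P F with P v in v∈P
  ... | true  = ok (P without v) (topple-forbidden c v P v∈P F)
  ... | false = ok P (topple-outside c v P v∈P F)

  reaches-allowed : ∀ {c d} → Reaches m n c d → Allowed c → Allowed d
  reaches-allowed ε        ok = ok
  reaches-allowed (s ◅ r) ok = reaches-allowed r (step-allowed s ok)

  -- With at least as many grains on each vertex as there are vertices,
  -- no vertex can be starved.
  saturated-allowed : ∀ c → (∀ w → (m ∸ 1) + n ≤ lookup c w) → Allowed c
  saturated-allowed c full P F with ∑-pos (boolToℕ ∘ P) (Forbidden.nonempty F)
  ... | w , w∈P = <-irrefl refl (begin-strict
    (m ∸ 1) + n      ≤⟨ full w ⟩
    lookup c w       <⟨ Forbidden.starved F w (boolToℕ-pos (P w) w∈P) ⟩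
    neighboursIn P w ≤⟨ neighboursIn≤size P w ⟩
    size P           ≤⟨ size≤vertices P ⟩
    (m ∸ 1) + n      ∎)
    where open ≤-Reasoning

  -- Recurrent configurations are reachable from the saturated one.
  recurrent-allowed : ∀ u → Recurrent m n u → Allowed u
  recurrent-allowed u (_ , reachable) =
    reaches-allowed (reachable full)
      (saturated-allowed full (λ w → ≤-reflexive (sym (lookup∘tabulate _ w))))
    where
    full : Config m n
    full = tabulate (λ _ → (m ∸ 1) + n)

open Burning

-- Vertex 1 + x is a top vertex iff x < k (m = 1 + k): vertex sums split
-- into a sum over the top heights and one over the bottom heights.

∑-parts : ∀ k {l} (u : Vec ℕ (k + l)) (h : Bool → ℕ → ℕ) →
          ∑[ x < k + l ] h (toℕ x <ᵇ k) (lookup u x)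
            ≡ sum (map (h true) (toList (take k u))) + sum (map (h false) (toList (drop k u)))
∑-parts zero    u       h = ∑-lookup (h false) u
∑-parts (suc k) (a ∷ u) h = trans (cong (_+_ (h true a)) (∑-parts k u h)) (sym (+-assoc (h true a) _ _))

All-parts : ∀ k {l} (u : Vec ℕ (k + l)) (R : Bool → ℕ → Set) →
            (∀ x → R (toℕ x <ᵇ k) (lookup u x)) →
            All (R true) (toList (take k u)) × All (R false) (toList (drop k u))
All-parts zero    u       R r = [] , rest u r
  where
  rest : ∀ {l} (u : Vec ℕ l) → (∀ x → R false (lookup u x)) → All (R false) (toList u)
  rest []      _ = []
  rest (a ∷ u) r = r fzero ∷ rest u (r ∘ fsuc)
All-parts (suc k) (a ∷ u) R r =
  let ts , bs = All-parts k u R (r ∘ fsuc) in r fzero ∷ ts , bs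

sum-map-zero : ∀ xs → sum (map (λ (_ : ℕ) → 0) xs) ≡ 0
sum-map-zero []       = refl
sum-map-zero (_ ∷ xs) = sum-map-zero xs

module Parts (k n : ℕ) (u : Config (suc k) n) where

  tops bots : List ℕ
  tops = toList (take k u)
  bots = toList (drop k u)

  sum-parts : sum (toList u) ≡ sum tops + sum bots
  sum-parts = trans (cong (sum ∘ toList) (sym (take++drop≡id k u)))
                    (trans (cong sum (toList-++ (take k u) (drop k u))) (sum-++ tops bots))

  stable-parts : Stable (suc k) n u → All (_< n) tops × All (_< suc k) bots
  stable-parts = All-parts k u (λ b y → y < (if b then n else suc k))

  partwise : (ℕ → Bool) → (ℕ → Bool) → VertexSet (suc k) n
  partwise φ ψ x = if isTop (suc k) n x then φ (lookup u x) else ψ (lookup u x)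

  size-partwise : ∀ φ ψ → size (suc k) n (partwise φ ψ) ≡ count φ tops + count ψ bots
  size-partwise φ ψ = ∑-parts k u (λ b y → boolToℕ (if b then φ y else ψ y))

  neighbours-top : ∀ φ ψ w → isTop (suc k) n w ≡ true →
                   neighboursIn (suc k) n (partwise φ ψ) w ≡ count ψ bots
  neighbours-top φ ψ w top rewrite top = begin
    ∑[ x < k + n ] boolToℕ (partwise φ ψ x ∧ not (isTop (suc k) n x)) ≡⟨ sum-cong-≗ term ⟩
    ∑[ x < k + n ] h (isTop (suc k) n x) (lookup u x)                  ≡⟨ ∑-parts k u h ⟩
    sum (map (λ _ → 0) tops) + count ψ bots                           ≡⟨ cong (_+ count ψ bots) (sum-map-zero tops) ⟩
    count ψ bots                                                      ∎
    where
    open ≡-Reasoning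
    h : Bool → ℕ → ℕ
    h b y = if b then 0 else boolToℕ (ψ y)
    term : ∀ x → boolToℕ (partwise φ ψ x ∧ not (isTop (suc k) n x)) ≡ h (isTop (suc k) n x) (lookup u x)
    term x with isTop (suc k) n x
    ... | true  = cong boolToℕ (∧-zeroʳ (φ (lookup u x)))
    ... | false = cong boolToℕ (∧-identityʳ (ψ (lookup u x)))

  neighbours-bottom : ∀ φ ψ w → isTop (suc k) n w ≡ false →
                      neighboursIn (suc k) n (partwise φ ψ) w ≡ count φ tops
  neighbours-bottom φ ψ w bottom rewrite bottom = begin
    ∑[ x < k + n ] boolToℕ (partwise φ ψ x ∧ isTop (suc k) n x) ≡⟨ sum-cong-≗ term ⟩
    ∑[ x < k + n ] h (isTop (suc k) n x) (lookup u x)           ≡⟨ ∑-parts k u h ⟩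
    count φ tops + sum (map (λ _ → 0) bots)                    ≡⟨ cong (_+_ (count φ tops)) (sum-map-zero bots) ⟩
    count φ tops + 0                                           ≡⟨ +-identityʳ _ ⟩
    count φ tops                                               ∎
    where
    open ≡-Reasoning
    h : Bool → ℕ → ℕ
    h b y = if b then boolToℕ (φ y) else 0
    term : ∀ x → boolToℕ (partwise φ ψ x ∧ isTop (suc k) n x) ≡ h (isTop (suc k) n x) (lookup u x)
    term x with isTop (suc k) n x
    ... | true  = cong boolToℕ (∧-identityʳ (φ (lookup u x)))
    ... | false = cong boolToℕ (∧-zeroʳ (ψ (lookup u x)))

module Young (k n : ℕ) (u : Config (suc k) n)
             (stable : Stable (suc k) n u) (allowed : Allowed (suc k) n u) where

  open Parts k n u

  as bs : List ℕ
  as = sort tops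
  bs = sort bots

  length-as : length as ≡ k
  length-as = trans (↭-length (sort-↭ tops)) (length-toList (take k u))

  length-bs : length bs ≡ n
  length-bs = trans (↭-length (sort-↭ bots)) (length-toList (drop k u))

  as<n : All (_< n) as
  as<n = All-resp-↭ (↭-sym (sort-↭ tops)) (proj₁ (stable-parts stable))

  bs<m : All (_< suc k) bs
  bs<m = All-resp-↭ (↭-sym (sort-↭ bots)) (proj₂ (stable-parts stable))

  H W : ℕ → ℕ
  H = colHeight (suc k) n u
  W = rowWidth (suc k) n u

  H-init : ∀ {i} → i < k → H i ≡ suc (at as i)
  H-init {i} i<k with i ≡ᵇ k in e
  ... | false = refl
  ... | true  = ⊥-elim (<-irrefl (≡ᵇ⇒≡ i k (Equivalence.from T-≡ e)) i<k)

  H-last : H k ≡ n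
  H-last rewrite Equivalence.to T-≡ (≡⇒≡ᵇ k k refl) = refl

  H≤n : ∀ {i} → i < suc k → H i ≤ n
  H≤n i<m with m<1+n⇒m<n∨m≡n i<m
  ... | inj₁ i<k  = subst (_≤ n) (sym (H-init i<k)) (All-at as as<n (subst (_ <_) (sym length-as) i<k))
  ... | inj₂ refl = ≤-reflexive H-last

  W≤m : ∀ {j} → j < n → W j ≤ suc k
  W≤m j<n = All-at bs bs<m (subst (_ <_) (sym length-bs) j<n)

  lowSet : ℕ → ℕ → VertexSet (suc k) n
  lowSet i j = partwise (_<ᵇ j) (_<ᵇ i)

  -- A cell (i , j) outside both diagrams: a_{i+1} < j and b_{j+1} < i.
  uncovered-forbidden : ∀ {i j} → i < k → j < n → at as i < j → at bs j < i →
                        Forbidden (suc k) n u (lowSet i j)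
  uncovered-forbidden {i} {j} i<k j<n aᵢ<j bⱼ<i = record { nonempty = nonempty ; starved = starved }
    where
    many-tops : suc i ≤ count (_<ᵇ j) tops
    many-tops = subst (suc i ≤_) (count-sort _ tops)
                  (count-sorted as (sort-↗ tops) (subst (i <_) (sym length-as) i<k) aᵢ<j)
    many-bots : suc j ≤ count (_<ᵇ i) bots
    many-bots = subst (suc j ≤_) (count-sort _ bots)
                  (count-sorted bs (sort-↗ bots) (subst (j <_) (sym length-bs) j<n) bⱼ<i)
    nonempty : 0 < size (suc k) n (lowSet i j)
    nonempty = subst (0 <_) (sym (size-partwise (_<ᵇ j) (_<ᵇ i))) (≤-trans (s≤s z≤n) (≤-trans many-tops (m≤m+n _ _)))
    starved : ∀ w → lowSet i j w ≡ true → lookup u w < neighboursIn (suc k) n (lowSet i j) w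
    starved w w∈ = by-part (isTop (suc k) n w) refl
      where
      below : lookup u w < (if isTop (suc k) n w then j else i)
      below = <ᵇ-if (isTop (suc k) n w) w∈
      by-part : ∀ b → isTop (suc k) n w ≡ b → lookup u w < neighboursIn (suc k) n (lowSet i j) w
      by-part true  top    = subst (lookup u w <_) (sym (neighbours-top (_<ᵇ j) (_<ᵇ i) w top))
                               (<-trans (subst (λ b → lookup u w < (if b then j else i)) top below) many-bots)
      by-part false bottom = subst (lookup u w <_) (sym (neighbours-bottom (_<ᵇ j) (_<ᵇ i) w bottom))
                               (<-trans (subst (λ b → lookup u w < (if b then j else i)) bottom below) many-tops)

  covered : ∀ {i j} → i < suc k → j < n → ((j <ᵇ H i) ∨ (i <ᵇ W j)) ≡ true
  covered {i} {j} i<m j<n with m<1+n⇒m<n∨m≡n i<m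
  ... | inj₂ refl rewrite H-last | <ᵇ-true j<n = refl
  ... | inj₁ i<k with j ≤? at as i | i ≤? at bs j
  ... | yes j≤aᵢ | _ rewrite H-init i<k | <ᵇ-true (s≤s j≤aᵢ) = refl
  ... | no _ | yes i≤bⱼ = trans (cong ((j <ᵇ H i) ∨_) (<ᵇ-true (s≤s i≤bⱼ))) (∨-zeroʳ (j <ᵇ H i))
  ... | no j≰aᵢ | no i≰bⱼ = ⊥-elim (allowed _ (uncovered-forbidden i<k j<n (≰⇒> j≰aᵢ) (≰⇒> i≰bⱼ)))

  ∑-colHeights : ∑[ i < suc k ] H (toℕ i) ≡ k + sum tops + n
  ∑-colHeights = begin
    ∑[ i < suc k ] H (toℕ i)                                  ≡⟨ sum-init-last {k} (H ∘ toℕ) ⟩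
    ∑[ i < k ] H (toℕ (inject₁ i)) + H (toℕ (fromℕ k))
      ≡⟨ cong₂ _+_ (sum-cong-≗ init) (trans (cong H (toℕ-fromℕ k)) H-last) ⟩
    ∑[ i < k ] (1 + at as (toℕ i)) + n                        ≡⟨ cong (_+ n) (∑-distrib-+ (λ (_ : Fin k) → 1) (at as ∘ toℕ)) ⟩
    ∑[ i < k ] 1 + ∑[ i < k ] at as (toℕ i) + n
      ≡⟨ cong₂ (λ a b → a + b + n) (trans (∑-const k 1) (*-identityʳ k))
                                     (trans (∑-at as length-as) (sum-↭ (sort-↭ tops))) ⟩
    k + sum tops + n                                         ∎
    where
    open ≡-Reasoning
    init : ∀ i → H (toℕ (inject₁ i)) ≡ 1 + at as (toℕ i)
    init i rewrite toℕ-inject₁ i = H-init (toℕ<n i)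

  ∑-rowWidths : ∑[ j < n ] W (toℕ j) ≡ n + sum bots
  ∑-rowWidths = begin
    ∑[ j < n ] (1 + at bs (toℕ j))                 ≡⟨ ∑-distrib-+ (λ (_ : Fin n) → 1) (at bs ∘ toℕ) ⟩
    ∑[ j < n ] 1 + ∑[ j < n ] at bs (toℕ j)        ≡⟨ cong₂ _+_ (trans (∑-const n 1) (*-identityʳ n))
                                                              (trans (∑-at bs length-bs) (sum-↭ (sort-↭ bots))) ⟩
    n + sum bots                                   ∎
    where open ≡-Reasoning

  area-∑∑ : area (suc k) n u ≡ ∑∑ {suc k} {n} (λ i j → boolToℕ (inF (suc k) n u (toℕ i) (toℕ j)))
  area-∑∑ = trans (∑-applyUpTo (suc k) column (λ i → i))
                  (sum-cong-≗ {suc k} (λ i → ∑-applyUpTo n (cell (toℕ i)) (λ j → j)))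
    where
    cell : ℕ → ℕ → ℕ
    cell i j = boolToℕ (inF (suc k) n u i j)
    column : ℕ → ℕ
    column i = sum (map (cell i) (applyUpTo (λ j → j) n))

  -- Inclusion-exclusion over the two covering diagrams.
  area-equation : area (suc k) n u + suc k * n ≡ (k + sum tops + n) + (n + sum bots)
  area-equation = begin
    area (suc k) n u + suc k * n                            ≡⟨ cong (_+ suc k * n) area-∑∑ ⟩
    ∑∑ (λ i j → boolToℕ (A i j ∧ B i j)) + suc k * n
      ≡⟨ ∑∑-covered (suc k) n A B (λ i j → covered (toℕ<n i) (toℕ<n j)) ⟩
    ∑∑ (λ i j → boolToℕ (A i j)) + ∑∑ (λ i j → boolToℕ (B i j))
      ≡⟨ cong₂ _+_ (sum-cong-≗ (λ i → ∑-below n (H (toℕ i)) (H≤n (toℕ<n i))))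
                   (trans (∑-comm (λ i j → boolToℕ (B i j))) (sum-cong-≗ (λ j → ∑-below (suc k) (W (toℕ j)) (W≤m (toℕ<n j))))) ⟩
    ∑[ i < suc k ] H (toℕ i) + ∑[ j < n ] W (toℕ j)        ≡⟨ cong₂ _+_ ∑-colHeights ∑-rowWidths ⟩
    (k + sum tops + n) + (n + sum bots)                     ∎
    where
    open ≡-Reasoning
    A : Fin (suc k) → Fin n → Bool
    A i j = toℕ j <ᵇ H (toℕ i)
    B : Fin (suc k) → Fin n → Bool
    B i j = toℕ i <ᵇ W (toℕ j)

  grain-count : sum (toList u) + (k + n) ≡ area (suc k) n u + n * k
  grain-count = +-cancelʳ-≡ n _ _ (begin
    sum (toList u) + (k + n) + n                 ≡⟨ cong (λ s → s + (k + n) + n) sum-parts ⟩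
    sum tops + sum bots + (k + n) + n            ≡⟨ regroup (sum tops) (sum bots) k n ⟩
    (k + sum tops + n) + (n + sum bots)          ≡⟨ area-equation ⟨
    area (suc k) n u + suc k * n                 ≡⟨ expand (area (suc k) n u) k n ⟩
    area (suc k) n u + n * k + n                 ∎)
    where
    open ≡-Reasoning
    regroup : ∀ s t k n → s + t + (k + n) + n ≡ (k + s + n) + (n + t)
    regroup = solve-∀
    expand : ∀ a k n → a + suc k * n ≡ a + n * k + n
    expand = solve-∀

sub-≡-sub : ∀ a b c d → a + d ≡ c + b → + a - + b ≡ + c - + d
sub-≡-sub a b c d a+d≡c+b = begin
  + a - + b          ≡⟨ m-n≡m⊖n a b ⟩
  a ⊖ b              ≡⟨ +-cancelˡ-⊖ d a b ⟨
  (d + a) ⊖ (d + b)  ≡⟨ cong₂ _⊖_ (trans (+-comm d a) (trans a+d≡c+b (+-comm c b))) (+-comm d b) ⟩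
  (b + c) ⊖ (b + d)  ≡⟨ +-cancelˡ-⊖ b c d ⟩
  c ⊖ d              ≡⟨ m-n≡m⊖n c d ⟨
  + c - + d          ∎
  where open ≡-Reasoning

mainTheorem4 : (m n : ℕ) → 1 ≤ m → 1 ≤ n → (u : Config m n) →
    Recurrent m n u →
    level m n u ≡ + area m n u - + (m + n ∸ 1)
mainTheorem4 zero    _ () _ _ _
mainTheorem4 (suc k) n _  _ u rec =
  sub-≡-sub (sum (toList u)) (n * k) (area (suc k) n u) (k + n)
    (Young.grain-count k n u (proj₁ rec) (recurrent-allowed (suc k) n u rec))
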